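{- Let $H$ be a connected plane graph, let $d:V(H)\to\mathbf{Z}$ satisfy $d(V(H))=0$, and let $s,t$ be faces of $H$. Let $h_1$ and $h_2$ be an $(s,t)$-circulation-maximum and an $(s,t)$-circulation-minimum $d$-flow in $H$, respectively, each with maximal support (with respect to inclusion) among such flows. Then there exist paths $Q_1,Q_2$ in $H^*$ from $s^*$ to $t^*$ with $\int_{Q_1}h_1^*=|E(Q_1)|$ and $\int_{Q_2}h_2^*=-|E(Q_2)|$. Furthermore, $E(H)\setminus\mathrm{supp}(h_1)$ and $E(H)\setminus\mathrm{supp}(h_2)$ are edge-sets of forests in $H$, and in particular if $d$ is even, then $\mathrm{supp}(h_1)=\mathrm{supp}(h_2)=E(H)$.
   Context: Graphs may have loops and parallel edges. Fix an orientation $\vec H$ of $H$. A $d$-flow is $h:E(\vec H)\to\{ -1,0,1\}$ with out-flow minus in-flow equal to $d(v)$ at every vertex $v$; its support $\mathrm{supp}(h)$ is the set of edges where $h\neq 0$. $H^*$ is the plane dual ($v^*,f^*,e^*$ the corresponding dual objects), oriented so that $e^*$ crosses $e$ from left to right when looking along $e$; $h^*(e^*)=h(e)$. For a walk $Q$ and edge $a$, $\sigma(Q,a)$ is the number of traversals of $a$ in its direction minus against it, and $\int_Q p=\sum_e p(e)\sigma(Q,e)$. A $d$-flow $h$ is $(s,t)$-circulation-maximum (resp. minimum) if $\int_Q h^*$ is maximum (resp. minimum) among all $d$-flows, where $Q$ is a path in $H^*$ from $s^*$ to $t^*$ (this does not depend on the choice of $Q$). $d$ is even if $d(v)\equiv\deg_H(v)\pmod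 2$ for every vertex $v$. -}

module Defs where

open import Data.Nat using (ℕ; zero; suc; _≤_)
open import Data.Integer as ℤ using (ℤ; +_; -_; _-_; 0ℤ; 1ℤ; -1ℤ)
open import Data.Integer.Divisibility using (_∣_)
open import Data.Fin using (Fin; zero; suc; _≟_)
open import Data.Bool using (Bool; true; false; if_then_else_)
open import Data.Product using (_×_; _,_; ∃; Σ)
open import Data.Sum using (_⊎_)
open import Data.List using (List; []; _∷_; length)
open import Data.List.Relation.Unary.All using (All)
open import Data.List.Relation.Unary.Unique.Propositional using (Unique)
open import Data.Empty using (⊥)
open import Relation.Nullary using (¬_; Dec; does)
open import Relation.Binary.PropositionalEquality using (_≡_; _≢_)

iter : {A : Set} → ℕ → (A → A) → A → A
iter zero    f x = x
iter (suc k) f x = f (iter k f x)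

ind : {P : Set} → Dec P → ℤ
ind p = if does p then 1ℤ else 0ℤ

ΣF : {n : ℕ} → (Fin n → ℤ) → ℤ
ΣF {zero}  f = 0ℤ
ΣF {suc n} f = f zero ℤ.+ ΣF (λ i → f (suc i))

record Graph : Set where
  field
    nV nE : ℕ
    tl hd : Fin nE → Fin nV

module _ (G : Graph) where
  open Graph G

  src tgt : Fin nE → Bool → Fin nV
  src e b = if b then tl e else hd e
  tgt e b = if b then hd e else tl e

  data Walk : Fin nV → Fin nV → Set where
    nil  : ∀ {u} → Walk u u
    cons : ∀ {w} (e : Fin nE) (b : Bool) → Walk (tgt e b) w → Walk (src e b) w

  edges : ∀ {u w} → Walk u w → List (Fin nE)
  edges nil          = []
  edges (cons e b q) = e ∷ edges q

  verts : ∀ {u w} → Walk u w → List (Fin nV)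
  verts {u} nil      = u ∷ []
  verts (cons e b q) = src e b ∷ verts q

  -- starting vertex of each step (for closed walks: every vertex once)
  stepVerts : ∀ {u w} → Walk u w → List (Fin nV)
  stepVerts nil          = []
  stepVerts (cons e b q) = src e b ∷ stepVerts q

  IsPath : ∀ {u w} → Walk u w → Set
  IsPath q = Unique (verts q)

  ∣E∣ : ∀ {u w} → Walk u w → ℕ
  ∣E∣ q = length (edges q)

  σ : ∀ {u w} → Walk u w → Fin nE → ℤ
  σ nil          a = 0ℤ
  σ (cons e b q) a = (if b then ind (e ≟ a) else - ind (e ≟ a)) ℤ.+ σ q a

  ∫ : ∀ {u w} → Walk u w → (Fin nE → ℤ) → ℤ
  ∫ q p = ΣF (λ e → p e ℤ.* σ q e)

  IsCycle : ∀ {v} → Walk v v → Set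
  IsCycle q = (1 ≤ ∣E∣ q) × Unique (edges q) × Unique (stepVerts q)

  IsForestEdges : (Fin nE → Set) → Set
  IsForestEdges F = ∀ {v} (q : Walk v v) → IsCycle q → All F (edges q) → ⊥

  Connected : Set
  Connected = ∀ (u w : Fin nV) → Walk u w

  -- degree (loops counted twice)
  deg : Fin nV → ℤ
  deg v = ΣF (λ e → ind (tl e ≟ v) ℤ.+ ind (hd e ≟ v))

  IsDFlow : (Fin nV → ℤ) → (Fin nE → ℤ) → Set
  IsDFlow d h =
    (∀ e → h e ≡ -1ℤ ⊎ h e ≡ 0ℤ ⊎ h e ≡ 1ℤ) ×
    (∀ v → ΣF (λ e → ind (tl e ≟ v) ℤ.* h e) - ΣF (λ e → ind (hd e ≟ v) ℤ.* h e) ≡ d v)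

  Supp : (Fin nE → ℤ) → Fin nE → Set
  Supp h e = h e ≢ 0ℤ

  IsEven : (Fin nV → ℤ) → Set
  IsEven d = ∀ v → (+ 2) ∣ (d v - deg v)

-- Connected plane graphs, as genus-0 combinatorial maps (rotation systems)

-- dart (e , true) runs along e (tail → head), (e , false) against it
Dart : ℕ → Set
Dart n = Fin n × Bool

α : ∀ {n} → Dart n → Dart n
α (e , true)  = (e , false)
α (e , false) = (e , true)

record PlaneGraph : Set where
  field
    graph : Graph
  open Graph graph public
  field
    nF : ℕ
    -- counter-clockwise successor of a dart around its tail vertex
    rot    : Dart nE → Dart nE
    rot⁻¹  : Dart nE → Dart nE
    rot-inv₁ : ∀ x → rot (rot⁻¹ x) ≡ x
    rot-inv₂ : ∀ x → rot⁻¹ (rot x) ≡ x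
    rot-vertex : ∀ x → src graph (Data.Product.proj₁ (rot x)) (Data.Product.proj₂ (rot x))
                       ≡ src graph (Data.Product.proj₁ x) (Data.Product.proj₂ x)
    rot-cyclic : ∀ x y → src graph (Data.Product.proj₁ x) (Data.Product.proj₂ x)
                         ≡ src graph (Data.Product.proj₁ y) (Data.Product.proj₂ y)
                       → ∃ λ k → iter k rot x ≡ y
    -- faces = orbits of φ = rot ∘ α; faceOf x is the face to the right of x
    faceOf : Dart nE → Fin nF
    faceOf-φ : ∀ x → faceOf (rot (α x)) ≡ faceOf x
    faceOf-orbit : ∀ x y → faceOf x ≡ faceOf y → ∃ λ k → iter k (λ z → rot (α z)) x ≡ y
    faceOf-surj : nE ≡ 0 ⊎ (∀ f → ∃ λ x → faceOf x ≡ f)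
    -- nonempty, connected, and genus 0 (Euler's formula)
    nonempty : 1 ≤ nV
    connected : Connected graph
    euler : nV Data.Nat.+ nF ≡ nE Data.Nat.+ 2

  -- the plane dual H*: vertices = faces, e* crosses e from left to right
  dual : Graph
  dual = record { nV = nF ; nE = nE
                ; tl = λ e → faceOf (e , false)
                ; hd = λ e → faceOf (e , true) }

module _ (H : PlaneGraph) where
  open PlaneGraph H

  IsCircMax IsCircMin : (Fin nV → ℤ) → Fin nF → Fin nF → (Fin nE → ℤ) → Set
  IsCircMax d s t h = IsDFlow graph d h ×
    (∀ (Q : Walk dual s t) → IsPath dual Q →
       ∀ h′ → IsDFlow graph d h′ → ∫ dual Q h′ ℤ.≤ ∫ dual Q h)
  IsCircMin d s t h = IsDFlow graph d h ×
    (∀ (Q : Walk dual s t) → IsPath dual Q →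
       ∀ h′ → IsDFlow graph d h′ → ∫ dual Q h ℤ.≤ ∫ dual Q h′)

  MaxSupport : ((Fin nE → ℤ) → Set) → (Fin nE → ℤ) → Set
  MaxSupport P h = P h ×
    (∀ h′ → P h′ → (∀ e → Supp graph h e → Supp graph h′ e) →
       ∀ e → Supp graph h′ e → Supp graph h e)

-- Adding a circulation c to a d-flow h gives a d-flow as long as h + c stays in {-1, 0, 1}.
-- Let h be (s,t)-circulation-maximum.
-- * Let R be the set of faces from which t* is reached by dual edges along which h is +1. If s* ∉ R,
--   the coboundary of the indicator of R is such a circulation, and it raises ∫_Q h by one for
--   every dual s*–t* path Q; so s* ∈ R, and a path inside such a walk is Q₁.
-- * If C is a cycle of zero edges, h ± σ(C) are d-flows, so maximality forces ∫_Q σ(C) = 0 and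
--   h + σ(C) is again circulation-maximum with strictly larger support. Hence the zero edges of a
--   support-maximal h form a forest.
-- * For even d every vertex meets an even number of zero edges; a graph with all degrees even has
--   no bridge, while every edge of a forest is a bridge. So there are no zero edges.
-- The minimum case is the maximum case for -h and -d.

module Submission where

open import Defs
open import Data.Nat as ℕ using (ℕ; zero; suc; z≤n; s≤s)
import Data.Nat.Properties as ℕP
open import Data.Integer as ℤ using (ℤ; +_; -_; _-_; 0ℤ; 1ℤ; -1ℤ; _+_; _*_)
import Data.Integer.Properties as ℤP
open import Data.Integer.Tactic.RingSolver using (solve-∀)
open import Data.Integer.Divisibility.Signed
  using (_∣_; divides; ∣-refl; ∣⇒∣ᵤ; ∣ᵤ⇒∣; ∣m∣n⇒∣m+n; ∣m+n∣m⇒∣n; ∣n⇒∣m*n; ∣m⇒∣m*n)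
import Data.Nat.Divisibility as ℕDiv
open import Data.Fin using (Fin; zero; suc; _≟_; _↑ˡ_; _↑ʳ_; splitAt)
open import Data.Fin.Properties using (+↔⊎; splitAt-↑ˡ; splitAt-↑ʳ; injective⇒≤; any?)
open import Data.Fin.Permutation using (Permutation; _⟨$⟩ʳ_)
open import Data.Bool using (Bool; true; false; if_then_else_)
open import Data.Product using (_×_; ∃; Σ-syntax; _,_; proj₁; proj₂)
open import Data.Sum using (_⊎_; inj₁; inj₂)
open import Function using (id; _∘_; Inverse; _↔_; mk↔ₛ′)
open import Function.Properties.Inverse using (↔-sym; ↔-trans)
open import Data.Unit using (⊤; tt)
open import Data.Empty using (⊥; ⊥-elim)
open import Data.List using (List; []; _∷_; length; lookup; _++_; [_])
open import Data.List.Relation.Unary.All as All using (All; []; _∷_)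
open import Data.List.Relation.Unary.All.Properties using (¬Any⇒All¬; ++⁻ˡ; ++⁻ʳ)
open import Data.List.Relation.Unary.Any using (here; there)
open import Data.List.Membership.Propositional using (_∈_; _∉_)
open import Data.List.Membership.Propositional.Properties using (∈-lookup)
import Data.List.Membership.DecPropositional as DecMembership
open import Data.List.Relation.Unary.Unique.Propositional using (Unique)
open import Data.List.Relation.Unary.AllPairs using ([]; _∷_)
open import Relation.Nullary using (Dec; yes; no; ¬_)
open import Relation.Nullary.Decidable using (_×-dec_; _⊎-dec_; ¬?)
open import Relation.Binary.PropositionalEquality hiding ([_])
open import Algebra.Properties.Semiring.Sum ℤP.+-*-semiring
  using (sum; sum-cong-≗; ∑-distrib-+; ∑-comm; sum-permute; *-distribˡ-sum)
open ≡-Reasoning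

ΣF≗sum : ∀ {n} (f : Fin n → ℤ) → ΣF f ≡ sum f
ΣF≗sum {zero}  f = refl
ΣF≗sum {suc n} f = cong (_+_ (f zero)) (ΣF≗sum (f ∘ suc))

ΣF-cong : ∀ {n} {f g : Fin n → ℤ} → (∀ i → f i ≡ g i) → ΣF f ≡ ΣF g
ΣF-cong {zero}  f≗g = refl
ΣF-cong {suc n} f≗g = cong₂ _+_ (f≗g zero) (ΣF-cong (f≗g ∘ suc))

ΣF-zero : ∀ n → ΣF {n} (λ _ → 0ℤ) ≡ 0ℤ
ΣF-zero zero    = refl
ΣF-zero (suc n) = trans (ℤP.+-identityˡ _) (ΣF-zero n)

ΣF-+ : ∀ {n} (f g : Fin n → ℤ) → ΣF (λ i → f i + g i) ≡ ΣF f + ΣF g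
ΣF-+ f g = begin
  ΣF (λ i → f i + g i)  ≡⟨ ΣF≗sum (λ i → f i + g i) ⟩
  sum (λ i → f i + g i) ≡⟨ ∑-distrib-+ f g ⟩
  sum f + sum g         ≡⟨ cong₂ _+_ (ΣF≗sum f) (ΣF≗sum g) ⟨
  ΣF f + ΣF g           ∎

*-distribˡ-ΣF : ∀ {n} c (f : Fin n → ℤ) → c * ΣF f ≡ ΣF (λ i → c * f i)
*-distribˡ-ΣF c f = begin
  c * ΣF f              ≡⟨ cong (c *_) (ΣF≗sum f) ⟩
  c * sum f             ≡⟨ *-distribˡ-sum c f ⟩
  sum (λ i → c * f i)   ≡⟨ ΣF≗sum (λ i → c * f i) ⟨
  ΣF (λ i → c * f i)    ∎

ΣF-neg : ∀ {n} (f : Fin n → ℤ) → ΣF (λ i → - f i) ≡ - ΣF f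
ΣF-neg f = begin
  ΣF (λ i → - f i)      ≡⟨ ΣF-cong (λ i → ℤP.-1*i≡-i (f i)) ⟨
  ΣF (λ i → -1ℤ * f i)  ≡⟨ *-distribˡ-ΣF -1ℤ f ⟨
  -1ℤ * ΣF f            ≡⟨ ℤP.-1*i≡-i (ΣF f) ⟩
  - ΣF f                ∎

ΣF-- : ∀ {n} (f g : Fin n → ℤ) → ΣF (λ i → f i - g i) ≡ ΣF f - ΣF g
ΣF-- f g = trans (ΣF-+ f (λ i → - g i)) (cong (_+_ (ΣF f)) (ΣF-neg g))

ΣF-comm : ∀ {m n} (f : Fin m → Fin n → ℤ) →
  ΣF (λ i → ΣF (λ j → f i j)) ≡ ΣF (λ j → ΣF (λ i → f i j))
ΣF-comm f = begin
  ΣF (λ i → ΣF (f i))               ≡⟨ ΣF-cong (ΣF≗sum ∘ f) ⟩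
  ΣF (λ i → sum (f i))              ≡⟨ ΣF≗sum (λ i → sum (f i)) ⟩
  sum (λ i → sum (f i))             ≡⟨ ∑-comm f ⟩
  sum (λ j → sum (λ i → f i j))     ≡⟨ ΣF≗sum (λ j → sum (λ i → f i j)) ⟨
  ΣF (λ j → sum (λ i → f i j))      ≡⟨ ΣF-cong (λ j → ΣF≗sum (λ i → f i j)) ⟨
  ΣF (λ j → ΣF (λ i → f i j))       ∎

ΣF-δ : ∀ {n} (e : Fin n) (g : Fin n → ℤ) → ΣF (λ a → g a * ind (e ≟ a)) ≡ g e
ΣF-δ {suc n} zero g = begin
  g zero * 1ℤ + ΣF (λ a → g (suc a) * 0ℤ)
    ≡⟨ cong₂ _+_ (ℤP.*-identityʳ (g zero)) (ΣF-cong (ℤP.*-zeroʳ ∘ g ∘ suc)) ⟩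
  g zero + ΣF {n} (λ _ → 0ℤ)
    ≡⟨ cong (_+_ (g zero)) (ΣF-zero n) ⟩
  g zero + 0ℤ
    ≡⟨ ℤP.+-identityʳ (g zero) ⟩
  g zero ∎
ΣF-δ {suc n} (suc e) g = begin
  g zero * 0ℤ + ΣF (λ a → g (suc a) * ind (suc e ≟ suc a))
    ≡⟨ cong₂ _+_ (ℤP.*-zeroʳ (g zero)) (ΣF-cong (λ a → cong (g (suc a) *_) (ind-suc a))) ⟩
  0ℤ + ΣF (λ a → g (suc a) * ind (e ≟ a))
    ≡⟨ ℤP.+-identityˡ _ ⟩
  ΣF (λ a → g (suc a) * ind (e ≟ a))
    ≡⟨ ΣF-δ e (g ∘ suc) ⟩
  g (suc e) ∎
  where
  ind-suc : ∀ a → ind (suc e ≟ suc a) ≡ ind (e ≟ a)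
  ind-suc a with e ≟ a
  ... | yes _ = refl
  ... | no  _ = refl

ΣF-splitAt : ∀ m {n} (g : Fin (m ℕ.+ n) → ℤ) → ΣF g ≡ ΣF (g ∘ (_↑ˡ n)) + ΣF (g ∘ (m ↑ʳ_))
ΣF-splitAt zero    g = sym (ℤP.+-identityˡ (ΣF g))
ΣF-splitAt (suc m) g = trans (cong (_+_ (g zero)) (ΣF-splitAt m (g ∘ suc))) (sym (ℤP.+-assoc (g zero) _ _))

ΣF-even : ∀ {n} (f : Fin n → ℤ) → (∀ i → + 2 ∣ f i) → + 2 ∣ ΣF f
ΣF-even {zero}  f 2∣f = divides 0ℤ refl
ΣF-even {suc n} f 2∣f = ∣m∣n⇒∣m+n (2∣f zero) (ΣF-even (f ∘ suc) (2∣f ∘ suc))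

ΣD : ∀ {n} → (Dart n → ℤ) → ℤ
ΣD f = ΣF (λ e → f (e , true) + f (e , false))

Dart↔⊎ : ∀ {n} → Dart n ↔ (Fin n ⊎ Fin n)
Dart↔⊎ = mk↔ₛ′ toSum fromSum (λ { (inj₁ e) → refl ; (inj₂ e) → refl })
                             (λ { (e , true) → refl ; (e , false) → refl })
  where
  toSum : ∀ {n} → Dart n → Fin n ⊎ Fin n
  toSum (e , true)  = inj₁ e
  toSum (e , false) = inj₂ e
  fromSum : ∀ {n} → Fin n ⊎ Fin n → Dart n
  fromSum (inj₁ e) = e , true
  fromSum (inj₂ e) = e , false

Dart↔Fin : ∀ {n} → Dart n ↔ Fin (n ℕ.+ n)
Dart↔Fin = ↔-trans Dart↔⊎ (↔-sym +↔⊎)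

ΣD≡sum : ∀ {n} (f : Dart n → ℤ) → ΣD f ≡ sum (f ∘ Inverse.from Dart↔Fin)
ΣD≡sum {n} f = begin
  ΣD f                                                ≡⟨ ΣF-+ (λ e → f (e , true)) (λ e → f (e , false)) ⟩
  ΣF (λ e → f (e , true)) + ΣF (λ e → f (e , false))  ≡⟨ cong₂ _+_ (ΣF-cong left) (ΣF-cong right) ⟨
  ΣF (g ∘ (_↑ˡ n)) + ΣF (g ∘ (n ↑ʳ_))                 ≡⟨ ΣF-splitAt n g ⟨
  ΣF g                                                ≡⟨ ΣF≗sum g ⟩
  sum g                                               ∎
  where
  g : Fin (n ℕ.+ n) → ℤ
  g = f ∘ Inverse.from Dart↔Fin
  left : ∀ e → g (e ↑ˡ n) ≡ f (e , true)
  left e rewrite splitAt-↑ˡ n e n = refl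
  right : ∀ e → g (n ↑ʳ e) ≡ f (e , false)
  right e rewrite splitAt-↑ʳ n n e = refl

ΣD-permute : ∀ {n} (π : Dart n ↔ Dart n) (f : Dart n → ℤ) → ΣD (f ∘ Inverse.to π) ≡ ΣD f
ΣD-permute π f = begin
  ΣD (f ∘ to π)              ≡⟨ ΣD≡sum (f ∘ to π) ⟩
  sum (f ∘ to π ∘ from D)    ≡⟨ sum-cong-≗ (λ i → cong f (strictlyInverseʳ D (to π (from D i)))) ⟨
  sum (g ∘ (P ⟨$⟩ʳ_))        ≡⟨ sum-permute g P ⟨
  sum g                      ≡⟨ ΣD≡sum f ⟨
  ΣD f                       ∎
  where
  open Inverse
  D = Dart↔Fin
  g = f ∘ from D
  P : Permutation _ _
  P = ↔-trans (↔-sym D) (↔-trans π D)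

odd-not-even : ∀ m → ¬ (+ 2 ∣ + 2 * m + 1ℤ)
odd-not-even m 2∣odd with ℕDiv.∣⇒≤ (∣⇒∣ᵤ (∣m+n∣m⇒∣n 2∣odd (∣m⇒∣m*n m ∣-refl)))
... | s≤s ()

+-cancelˡ-≤0 : ∀ x y → x + y ℤ.≤ x → y ℤ.≤ 0ℤ
+-cancelˡ-≤0 x y x+y≤x = subst (ℤ._≤ 0ℤ) (cancel x y) (ℤP.i≤j⇒i-j≤0 x+y≤x)
  where
  cancel : ∀ x y → (x + y) - x ≡ y
  cancel = solve-∀

ind-yes : ∀ {P : Set} → P → (p? : Dec P) → ind p? ≡ 1ℤ
ind-yes p (yes _) = refl
ind-yes p (no ¬p) = ⊥-elim (¬p p)

ind-no : ∀ {P : Set} → ¬ P → (p? : Dec P) → ind p? ≡ 0ℤ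
ind-no ¬p (yes p) = ⊥-elim (¬p p)
ind-no ¬p (no _)  = refl

≤-neg-swap : ∀ {x y} → x ℤ.≤ - y → y ℤ.≤ - x
≤-neg-swap {x} {y} x≤-y = subst (ℤ._≤ - x) (ℤP.neg-involutive y) (ℤP.neg-mono-≤ x≤-y)

neg-≤-swap : ∀ {x y} → - x ℤ.≤ y → - y ℤ.≤ x
neg-≤-swap {x} {y} -x≤y = subst (- y ℤ.≤_) (ℤP.neg-involutive x) (ℤP.neg-mono-≤ -x≤y)

Trit : ℤ → Set
Trit x = x ≡ -1ℤ ⊎ x ≡ 0ℤ ⊎ x ≡ 1ℤ

neg-trit : ∀ {x} → Trit x → Trit (- x)
neg-trit (inj₁ refl)        = inj₂ (inj₂ refl)
neg-trit (inj₂ (inj₁ refl)) = inj₂ (inj₁ refl)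
neg-trit (inj₂ (inj₂ refl)) = inj₁ refl

orient : Bool → ℤ → ℤ
orient b x = if b then x else - x

neg-minus : ∀ x y → - (x - y) ≡ y - x
neg-minus = solve-∀

orient-trit : ∀ b {x} → Trit x → Trit (orient b x)
orient-trit true  = id
orient-trit false = neg-trit

orient-zero : ∀ b → orient b 0ℤ ≡ 0ℤ
orient-zero true  = refl
orient-zero false = refl

*-orient : ∀ b x y → x * orient b y ≡ orient b (x * y)
*-orient true  x y = refl
*-orient false x y = sym (ℤP.neg-distribʳ-* x y)

ΣF-orient : ∀ {n} b (f : Fin n → ℤ) → ΣF (λ i → orient b (f i)) ≡ orient b (ΣF f)
ΣF-orient true  f = refl
ΣF-orient false f = ΣF-neg f

unique-length≤ : ∀ {n} {xs : List (Fin n)} → Unique xs → length xs ℕ.≤ n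
unique-length≤ u = injective⇒≤ (lookup-injective u)
  where
  lookup-injective : ∀ {n} {xs : List (Fin n)} → Unique xs → ∀ {i j} → lookup xs i ≡ lookup xs j → i ≡ j
  lookup-injective (x∉xs ∷ u) {zero}  {zero}  eq = refl
  lookup-injective (x∉xs ∷ u) {zero}  {suc j} eq = ⊥-elim (All.lookup x∉xs (∈-lookup j) eq)
  lookup-injective (x∉xs ∷ u) {suc i} {zero}  eq = ⊥-elim (All.lookup x∉xs (∈-lookup i) (sym eq))
  lookup-injective (x∉xs ∷ u) {suc i} {suc j} eq = cong suc (lookup-injective u eq)

subsingleton⇒≤1 : ∀ {n} → (∀ (i j : Fin n) → i ≡ j) → n ℕ.≤ 1
subsingleton⇒≤1 {zero}        _   = z≤n
subsingleton⇒≤1 {suc zero}    _   = s≤s z≤n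
subsingleton⇒≤1 {suc (suc n)} all with all zero (suc zero)
... | ()

Fin1-subsingleton : ∀ {n} → n ≡ 1 → (i j : Fin n) → i ≡ j
Fin1-subsingleton refl zero zero = refl

Unique-∷ʳ : ∀ {A : Set} (xs : List A) (w : A) → Unique (xs ++ [ w ]) → Unique (w ∷ xs)
Unique-∷ʳ []       w u               = [] ∷ []
Unique-∷ʳ (x ∷ xs) w (x∉xs+w ∷ u) with Unique-∷ʳ xs w u
... | w∉xs ∷ uxs = (w≢x ∷ w∉xs) ∷ (++⁻ˡ xs x∉xs+w ∷ uxs)
  where
  w≢x : w ≢ x
  w≢x w≡x = All.lookup (++⁻ʳ xs x∉xs+w) (here refl) (sym w≡x)

module _ (G : Graph) where
  open Graph G
  open DecMembership (_≟_ {nV}) using (_∈?_)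

  ∫-nil : ∀ {u} (p : Fin nE → ℤ) → ∫ G (nil {u = u}) p ≡ 0ℤ
  ∫-nil p = trans (ΣF-cong (ℤP.*-zeroʳ ∘ p)) (ΣF-zero nE)

  ∫-cons : ∀ {w} e b (q : Walk G (tgt G e b) w) (p : Fin nE → ℤ) →
    ∫ G (cons e b q) p ≡ orient b (p e) + ∫ G q p
  ∫-cons e b q p = begin
    ΣF (λ a → p a * (orient b (ind (e ≟ a)) + σ G q a))
      ≡⟨ ΣF-cong (λ a → ℤP.*-distribˡ-+ (p a) _ (σ G q a)) ⟩
    ΣF (λ a → p a * orient b (ind (e ≟ a)) + p a * σ G q a)
      ≡⟨ ΣF-+ (λ a → p a * orient b (ind (e ≟ a))) (λ a → p a * σ G q a) ⟩
    ΣF (λ a → p a * orient b (ind (e ≟ a))) + ∫ G q p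
      ≡⟨ cong (_+ ∫ G q p) (ΣF-cong (λ a → *-orient b (p a) (ind (e ≟ a)))) ⟩
    ΣF (λ a → orient b (p a * ind (e ≟ a))) + ∫ G q p
      ≡⟨ cong (_+ ∫ G q p) (ΣF-orient b (λ a → p a * ind (e ≟ a))) ⟩
    orient b (ΣF (λ a → p a * ind (e ≟ a))) + ∫ G q p
      ≡⟨ cong (λ x → orient b x + ∫ G q p) (ΣF-δ e p) ⟩
    orient b (p e) + ∫ G q p ∎

  ∫-+ : ∀ {u w} (q : Walk G u w) (f g : Fin nE → ℤ) → ∫ G q (λ a → f a + g a) ≡ ∫ G q f + ∫ G q g
  ∫-+ q f g = trans (ΣF-cong (λ a → ℤP.*-distribʳ-+ (σ G q a) (f a) (g a)))
                    (ΣF-+ (λ a → f a * σ G q a) (λ a → g a * σ G q a))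

  ∫-neg : ∀ {u w} (q : Walk G u w) (f : Fin nE → ℤ) → ∫ G q (λ a → - f a) ≡ - ∫ G q f
  ∫-neg q f = trans (ΣF-cong (λ a → sym (ℤP.neg-distribˡ-* (f a) (σ G q a)))) (ΣF-neg (λ a → f a * σ G q a))

  ∫-potential : ∀ (g : Fin nV → ℤ) {u w} (q : Walk G u w) → ∫ G q (λ e → g (hd e) - g (tl e)) ≡ g w - g u
  ∫-potential g {u} nil = trans (∫-nil {u} (λ e → g (hd e) - g (tl e))) (sym (ℤP.+-inverseʳ (g u)))
  ∫-potential g {w = w} (cons e b q) = begin
    ∫ G (cons e b q) (λ e → g (hd e) - g (tl e))
      ≡⟨ ∫-cons e b q (λ e → g (hd e) - g (tl e)) ⟩
    orient b (g (hd e) - g (tl e)) + ∫ G q (λ e → g (hd e) - g (tl e))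
      ≡⟨ cong₂ _+_ (step b) (∫-potential g q) ⟩
    (g (tgt G e b) - g (src G e b)) + (g w - g (tgt G e b))
      ≡⟨ telescope (g (src G e b)) (g (tgt G e b)) (g w) ⟩
    g w - g (src G e b) ∎
    where
    step : ∀ b → orient b (g (hd e) - g (tl e)) ≡ g (tgt G e b) - g (src G e b)
    step true  = refl
    step false = neg-minus (g (hd e)) (g (tl e))
    telescope : ∀ x y z → (y - x) + (z - y) ≡ z - x
    telescope = solve-∀

  net : (Fin nE → ℤ) → Fin nV → ℤ
  net h v = ΣF (λ e → ind (tl e ≟ v) * h e) - ΣF (λ e → ind (hd e ≟ v) * h e)

  IsCirculation : (Fin nE → ℤ) → Set
  IsCirculation c = ∀ v → net c v ≡ 0ℤ

  incidence : Fin nE → Fin nV → ℤ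
  incidence e v = ind (tl e ≟ v) - ind (hd e ≟ v)

  net≡ΣF : ∀ h v → net h v ≡ ΣF (λ e → incidence e v * h e)
  net≡ΣF h v = sym (trans (ΣF-cong (λ e → distribʳ-- (ind (tl e ≟ v)) (ind (hd e ≟ v)) (h e)))
                          (ΣF-- (λ e → ind (tl e ≟ v) * h e) (λ e → ind (hd e ≟ v) * h e)))
    where
    distribʳ-- : ∀ x y z → (x - y) * z ≡ x * z - y * z
    distribʳ-- = solve-∀

  net-+ : ∀ f g v → net (λ a → f a + g a) v ≡ net f v + net g v
  net-+ f g v = begin
    net (λ a → f a + g a) v
      ≡⟨ net≡ΣF (λ a → f a + g a) v ⟩
    ΣF (λ e → incidence e v * (f e + g e))
      ≡⟨ ΣF-cong (λ e → ℤP.*-distribˡ-+ (incidence e v) (f e) (g e)) ⟩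
    ΣF (λ e → incidence e v * f e + incidence e v * g e)
      ≡⟨ ΣF-+ (λ e → incidence e v * f e) (λ e → incidence e v * g e) ⟩
    ΣF (λ e → incidence e v * f e) + ΣF (λ e → incidence e v * g e)
      ≡⟨ cong₂ _+_ (net≡ΣF f v) (net≡ΣF g v) ⟨
    net f v + net g v ∎

  net-orient : ∀ b f v → net (λ a → orient b (f a)) v ≡ orient b (net f v)
  net-orient b f v = begin
    net (λ a → orient b (f a)) v                  ≡⟨ net≡ΣF (λ a → orient b (f a)) v ⟩
    ΣF (λ e → incidence e v * orient b (f e))     ≡⟨ ΣF-cong (λ e → *-orient b (incidence e v) (f e)) ⟩
    ΣF (λ e → orient b (incidence e v * f e))     ≡⟨ ΣF-orient b (λ e → incidence e v * f e) ⟩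
    orient b (ΣF (λ e → incidence e v * f e))     ≡⟨ cong (orient b) (net≡ΣF f v) ⟨
    orient b (net f v)                            ∎

  net-σ : ∀ {u w} (q : Walk G u w) v → net (σ G q) v ≡ ind (u ≟ v) - ind (w ≟ v)
  net-σ {u} nil v = begin
    net (λ _ → 0ℤ) v                     ≡⟨ net≡ΣF (λ _ → 0ℤ) v ⟩
    ΣF (λ e → incidence e v * 0ℤ)        ≡⟨ ΣF-cong (λ e → ℤP.*-zeroʳ (incidence e v)) ⟩
    ΣF {nE} (λ _ → 0ℤ)                   ≡⟨ ΣF-zero nE ⟩
    0ℤ                                   ≡⟨ ℤP.+-inverseʳ (ind (u ≟ v)) ⟨
    ind (u ≟ v) - ind (u ≟ v)            ∎
  net-σ {w = w} (cons e b q) v = begin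
    net (λ a → orient b (ind (e ≟ a)) + σ G q a) v
      ≡⟨ net-+ (λ a → orient b (ind (e ≟ a))) (σ G q) v ⟩
    net (λ a → orient b (ind (e ≟ a))) v + net (σ G q) v
      ≡⟨ cong₂ _+_ (trans (net-orient b (λ a → ind (e ≟ a)) v) (cong (orient b) δ-net)) (net-σ q v) ⟩
    orient b (incidence e v) + (ind (tgt G e b ≟ v) - ind (w ≟ v))
      ≡⟨ cong (_+ (ind (tgt G e b ≟ v) - ind (w ≟ v))) (step b) ⟩
    (ind (src G e b ≟ v) - ind (tgt G e b ≟ v)) + (ind (tgt G e b ≟ v) - ind (w ≟ v))
      ≡⟨ telescope (ind (src G e b ≟ v)) (ind (tgt G e b ≟ v)) (ind (w ≟ v)) ⟩
    ind (src G e b ≟ v) - ind (w ≟ v) ∎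
    where
    δ-net : net (λ a → ind (e ≟ a)) v ≡ incidence e v
    δ-net = trans (net≡ΣF (λ a → ind (e ≟ a)) v) (ΣF-δ e (λ a → incidence a v))
    step : ∀ b → orient b (incidence e v) ≡ ind (src G e b ≟ v) - ind (tgt G e b ≟ v)
    step true  = refl
    step false = neg-minus (ind (tl e ≟ v)) (ind (hd e ≟ v))
    telescope : ∀ x y z → (x - y) + (y - z) ≡ x - z
    telescope = solve-∀

  σ-closed-circulation : ∀ {v} (q : Walk G v v) → IsCirculation (σ G q)
  σ-closed-circulation {v} q u = trans (net-σ q u) (ℤP.+-inverseʳ (ind (v ≟ u)))

  flow+circulation : ∀ {d h c} → IsDFlow G d h → IsCirculation c → (∀ a → Trit (h a + c a)) →
    IsDFlow G d (λ a → h a + c a)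
  flow+circulation {d} {h} {c} (_ , conserves) circ trit = trit , λ v → begin
    net (λ a → h a + c a) v   ≡⟨ net-+ h c v ⟩
    net h v + net c v         ≡⟨ cong₂ _+_ (conserves v) (circ v) ⟩
    d v + 0ℤ                  ≡⟨ ℤP.+-identityʳ (d v) ⟩
    d v                       ∎

  neg-circulation : ∀ {c} → IsCirculation c → IsCirculation (λ a → - c a)
  neg-circulation {c} circ v = trans (net-orient false c v) (cong -_ (circ v))

  neg-flow : ∀ {d d′ h} → (∀ v → d′ v ≡ - d v) → IsDFlow G d h → IsDFlow G d′ (λ a → - h a)
  neg-flow {d} {d′} {h} d′≡-d (trit , conserves) =
    neg-trit ∘ trit , λ v → trans (net-orient false h v) (trans (cong -_ (conserves v)) (sym (d′≡-d v)))

  σ-∉ : ∀ {u w} (q : Walk G u w) {a} → a ∉ edges G q → σ G q a ≡ 0ℤ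
  σ-∉ nil          a∉q = refl
  σ-∉ (cons e b q) {a} a∉q with e ≟ a
  ... | yes refl = ⊥-elim (a∉q (here refl))
  ... | no  _    = cong₂ _+_ (orient-zero b) (σ-∉ q (a∉q ∘ there))

  σ-cons-head : ∀ {w} e b (q : Walk G (tgt G e b) w) → e ∉ edges G q → σ G (cons e b q) e ≡ orient b 1ℤ
  σ-cons-head e b q e∉q with e ≟ e
  ... | yes _   = trans (cong (_+_ (orient b 1ℤ)) (σ-∉ q e∉q)) (ℤP.+-identityʳ (orient b 1ℤ))
  ... | no e≢e = ⊥-elim (e≢e refl)

  σ-trit : ∀ {u w} (q : Walk G u w) → Unique (edges G q) → ∀ a → Trit (σ G q a)
  σ-trit nil          _            a = inj₂ (inj₁ refl)
  σ-trit (cons e b q) (e∉q ∷ uq) a with e ≟ a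
  ... | yes refl rewrite σ-∉ q (λ e∈q → All.lookup e∉q e∈q refl) = orient-one b
    where
    orient-one : ∀ b → Trit (orient b 1ℤ + 0ℤ)
    orient-one true  = inj₂ (inj₂ refl)
    orient-one false = inj₁ refl
  ... | no  _    = subst Trit (sym (trans (cong (_+ σ G q a) (orient-zero b)) (ℤP.+-identityˡ (σ G q a))))
                         (σ-trit q uq a)

  AllSteps : (Fin nE → Bool → Set) → ∀ {u w} → Walk G u w → Set
  AllSteps P nil          = ⊤
  AllSteps P (cons e b q) = P e b × AllSteps P q

  AllSteps⇒All : ∀ {P : Fin nE → Bool → Set} {Q : Fin nE → Set} → (∀ {e} b → P e b → Q e) →
    ∀ {u w} (q : Walk G u w) → AllSteps P q → All Q (edges G q)
  AllSteps⇒All P⇒Q nil          _          = []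
  AllSteps⇒All P⇒Q (cons e b q) (pe , pq) = P⇒Q b pe ∷ AllSteps⇒All P⇒Q q pq

  AllSteps-trivial : ∀ {u w} (q : Walk G u w) → AllSteps (λ _ _ → ⊤) q
  AllSteps-trivial nil          = tt
  AllSteps-trivial (cons e b q) = tt , AllSteps-trivial q

  edgeless-walk : (Fin nE → ⊥) → ∀ {u w} → Walk G u w → u ≡ w
  edgeless-walk no-edge nil          = refl
  edgeless-walk no-edge (cons e b q) = ⊥-elim (no-edge e)

  _++ʷ_ : ∀ {u v w} → Walk G u v → Walk G v w → Walk G u w
  nil        ++ʷ r = r
  cons e b q ++ʷ r = cons e b (q ++ʷ r)

  verts≡stepVerts∷ʳ : ∀ {u w} (q : Walk G u w) → verts G q ≡ stepVerts G q ++ [ w ]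
  verts≡stepVerts∷ʳ nil          = refl
  verts≡stepVerts∷ʳ (cons e b q) = cong (src G e b ∷_) (verts≡stepVerts∷ʳ q)

  length-verts : ∀ {u w} (q : Walk G u w) → length (verts G q) ≡ suc (∣E∣ G q)
  length-verts nil          = refl
  length-verts (cons e b q) = cong suc (length-verts q)

  path-∣E∣<nV : ∀ {u w} (q : Walk G u w) → IsPath G q → ∣E∣ G q ℕ.< nV
  path-∣E∣<nV q path = subst (ℕ._≤ nV) (length-verts q) (unique-length≤ path)

  start∈verts : ∀ {u w} (q : Walk G u w) → u ∈ verts G q
  start∈verts nil          = here refl
  start∈verts (cons e b q) = here refl

  endpoints∈verts : ∀ {u w} (q : Walk G u w) {e} → e ∈ edges G q → tl e ∈ verts G q × hd e ∈ verts G q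
  endpoints∈verts (cons e true  q) (here refl) = here refl , there (start∈verts q)
  endpoints∈verts (cons e false q) (here refl) = there (start∈verts q) , here refl
  endpoints∈verts (cons e b q) (there e∈q) with endpoints∈verts q e∈q
  ... | tl∈q , hd∈q = there tl∈q , there hd∈q

  path-edges-unique : ∀ {u w} (q : Walk G u w) → IsPath G q → Unique (edges G q)
  path-edges-unique nil          _              = []
  path-edges-unique (cons e b q) (u∉q ∷ path) = All.tabulate e∉q ∷ path-edges-unique q path
    where
    src∈verts : ∀ b → tl e ∈ verts G q × hd e ∈ verts G q → src G e b ∈ verts G q
    src∈verts true  = proj₁
    src∈verts false = proj₂
    e∉q : ∀ {a} → a ∈ edges G q → e ≢ a
    e∉q a∈q refl = All.lookup u∉q (src∈verts b (endpoints∈verts q a∈q)) refl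

  module _ (P : Fin nE → Bool → Set) where

    PathWithin : Fin nV → Fin nV → Set
    PathWithin u w = Σ[ r ∈ Walk G u w ] IsPath G r × AllSteps P r

    private
      suffix : ∀ {x u w} (p : Walk G x w) → u ∈ verts G p → IsPath G p → AllSteps P p → PathWithin u w
      suffix nil          (here refl) path ps        = nil , path , ps
      suffix (cons e b p) (here refl) path ps        = cons e b p , path , ps
      suffix (cons e b p) (there u∈p) (_ ∷ path) (_ , ps) = suffix p u∈p path ps

    toPath : ∀ {u w} (q : Walk G u w) → AllSteps P q → PathWithin u w
    toPath nil          _         = nil , [] ∷ [] , tt
    toPath (cons e b q) (pe , ps) with toPath q ps
    ... | r , path , pr with src G e b ∈? verts G r
    ...   | yes u∈r = suffix r u∈r path pr
    ...   | no  u∉r = cons e b r , ¬Any⇒All¬ (verts G r) u∉r ∷ path , pe , pr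

  module Reachability (P : Fin nE → Bool → Set) (P? : ∀ e b → Dec (P e b)) (t : Fin nV) where

    Reaches : Fin nV → Set
    Reaches u = Σ[ q ∈ Walk G u t ] AllSteps P q

    reaches-step : ∀ {e b} → P e b → Reaches (tgt G e b) → Reaches (src G e b)
    reaches-step {e} {b} pe (q , pq) = cons e b q , pe , pq

    private
      ReachesWithin : ℕ → Fin nV → Set
      ReachesWithin k u = Σ[ q ∈ Walk G u t ] AllSteps P q × ∣E∣ G q ℕ.≤ k

      FirstStep : ℕ → Fin nV → Fin nE → Bool → Set
      FirstStep k u e b = src G e b ≡ u × P e b × ReachesWithin k (tgt G e b)

      extend : ∀ {k u e b} → FirstStep k u e b → ReachesWithin (suc k) u
      extend {e = e} {b} (refl , pe , q , pq , len) = cons e b q , (pe , pq) , s≤s len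

      firstStep : ∀ {k u} → u ≢ t → ReachesWithin (suc k) u → ∃ λ e → FirstStep k u e true ⊎ FirstStep k u e false
      firstStep u≢t (nil , _)                                   = ⊥-elim (u≢t refl)
      firstStep u≢t (cons e true  q , (pe , pq) , s≤s len) = e , inj₁ (refl , pe , q , pq , len)
      firstStep u≢t (cons e false q , (pe , pq) , s≤s len) = e , inj₂ (refl , pe , q , pq , len)

      reachesWithin? : ∀ k u → Dec (ReachesWithin k u)
      reachesWithin? k u with u ≟ t
      ... | yes refl = yes (nil , tt , z≤n)
      reachesWithin? zero    u | no u≢t = no λ { (nil , _) → u≢t refl ; (cons _ _ _ , _ , ()) }
      reachesWithin? (suc k) u | no u≢t with any? (λ e → firstStep? e true ⊎-dec firstStep? e false)
        where
        firstStep? : ∀ e b → Dec (FirstStep k u e b)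
        firstStep? e b = (src G e b ≟ u) ×-dec (P? e b ×-dec reachesWithin? k (tgt G e b))
      ... | yes (e , inj₁ step) = yes (extend step)
      ... | yes (e , inj₂ step) = yes (extend step)
      ... | no ¬step            = no (¬step ∘ firstStep u≢t)

    reaches? : ∀ u → Dec (Reaches u)
    reaches? u with reachesWithin? nV u
    ... | yes (q , pq , _) = yes (q , pq)
    ... | no ¬reach        = no λ (q , pq) → shorten (toPath P q pq)
      where
      shorten : PathWithin P u t → ⊥
      shorten (r , path , pr) = ¬reach (r , pr , ℕP.<⇒≤ (path-∣E∣<nV r path))

  forest-edge-is-bridge : ∀ {F : Fin nE → Set} → IsForestEdges G F → ∀ {e₀} → F e₀ →
    ¬ (Σ[ q ∈ Walk G (tl e₀) (hd e₀) ] AllSteps (λ e _ → F e × e ≢ e₀) q)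
  forest-edge-is-bridge {F} forest {e₀} Fe₀ (q , pq) with toPath (λ e _ → F e × e ≢ e₀) q pq
  ... | r , path , pr =
    forest (cons e₀ false r) (s≤s z≤n , edges-unique , stepVerts-unique) (Fe₀ ∷ AllSteps⇒All (λ _ → proj₁) r pr)
    where
    edges-unique : Unique (e₀ ∷ edges G r)
    edges-unique = AllSteps⇒All (λ _ (_ , e≢e₀) e₀≡e → e≢e₀ (sym e₀≡e)) r pr ∷ path-edges-unique r path
    stepVerts-unique : Unique (hd e₀ ∷ stepVerts G r)
    stepVerts-unique = Unique-∷ʳ (stepVerts G r) (hd e₀) (subst Unique (verts≡stepVerts∷ʳ r) path)

  degreeIn : (Fin nE → ℤ) → Fin nV → ℤ
  degreeIn z v = ΣF (λ e → z e * (ind (tl e ≟ v) + ind (hd e ≟ v)))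

  handshake : ∀ z (r : Fin nV → ℤ) → ΣF (λ v → r v * degreeIn z v) ≡ ΣF (λ e → z e * (r (tl e) + r (hd e)))
  handshake z r = begin
    ΣF (λ v → r v * degreeIn z v)
      ≡⟨ ΣF-cong (λ v → *-distribˡ-ΣF (r v) (λ e → z e * ends e v)) ⟩
    ΣF (λ v → ΣF (λ e → r v * (z e * ends e v)))
      ≡⟨ ΣF-comm (λ v e → r v * (z e * ends e v)) ⟩
    ΣF (λ e → ΣF (λ v → r v * (z e * ends e v)))
      ≡⟨ ΣF-cong at-edge ⟩
    ΣF (λ e → z e * (r (tl e) + r (hd e))) ∎
    where
    ends : Fin nE → Fin nV → ℤ
    ends e v = ind (tl e ≟ v) + ind (hd e ≟ v)
    rearrange : ∀ x y a b → x * (y * (a + b)) ≡ y * (x * a + x * b)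
    rearrange = solve-∀
    at-edge : ∀ e → ΣF (λ v → r v * (z e * ends e v)) ≡ z e * (r (tl e) + r (hd e))
    at-edge e = begin
      ΣF (λ v → r v * (z e * ends e v))
        ≡⟨ ΣF-cong (λ v → rearrange (r v) (z e) (ind (tl e ≟ v)) (ind (hd e ≟ v))) ⟩
      ΣF (λ v → z e * (r v * ind (tl e ≟ v) + r v * ind (hd e ≟ v)))
        ≡⟨ *-distribˡ-ΣF (z e) (λ v → r v * ind (tl e ≟ v) + r v * ind (hd e ≟ v)) ⟨
      z e * ΣF (λ v → r v * ind (tl e ≟ v) + r v * ind (hd e ≟ v))
        ≡⟨ cong (z e *_) (ΣF-+ (λ v → r v * ind (tl e ≟ v)) (λ v → r v * ind (hd e ≟ v))) ⟩
      z e * (ΣF (λ v → r v * ind (tl e ≟ v)) + ΣF (λ v → r v * ind (hd e ≟ v)))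
        ≡⟨ cong (z e *_) (cong₂ _+_ (ΣF-δ (tl e) r) (ΣF-δ (hd e) r)) ⟩
      z e * (r (tl e) + r (hd e)) ∎

  module _ {Z : Fin nE → Set} (Z? : ∀ e → Dec (Z e)) {e₀ : Fin nE} where
    private
      open Reachability (λ e _ → Z e × e ≢ e₀) (λ e _ → Z? e ×-dec ¬? (e ≟ e₀)) (hd e₀)

      r : Fin nV → ℤ
      r v = ind (reaches? v)

      z : Fin nE → ℤ
      z e = ind (Z? e)

      r-constant-on-Z : ∀ {e} → Z e → e ≢ e₀ → r (tl e) ≡ r (hd e)
      r-constant-on-Z {e} Ze e≢e₀ with reaches? (tl e) | reaches? (hd e)
      ... | yes _    | yes _    = refl
      ... | no  _    | no  _    = refl
      ... | yes from-tl | no ¬from-hd = ⊥-elim (¬from-hd (reaches-step {b = false} (Ze , e≢e₀) from-tl))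
      ... | no ¬from-tl | yes from-hd = ⊥-elim (¬from-tl (reaches-step {b = true} (Ze , e≢e₀) from-hd))

      e₀-crosses : Z e₀ → ¬ Reaches (tl e₀) → z e₀ * (r (tl e₀) + r (hd e₀)) ≡ + 2 * (z e₀ * r (tl e₀)) + 1ℤ
      e₀-crosses Ze₀ ¬reach with Z? e₀ | reaches? (tl e₀) | reaches? (hd e₀)
      ... | yes _   | no _      | yes _     = refl
      ... | no ¬Ze₀ | _         | _         = ⊥-elim (¬Ze₀ Ze₀)
      ... | _       | yes reach | _         = ⊥-elim (¬reach reach)
      ... | _       | _         | no ¬start = ⊥-elim (¬start (nil , tt))

      only-e₀-crosses : Z e₀ → ¬ Reaches (tl e₀) →
        ∀ e → z e * (r (tl e) + r (hd e)) ≡ + 2 * (z e * r (tl e)) + ind (e₀ ≟ e)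
      only-e₀-crosses Ze₀ ¬reach e with e₀ ≟ e
      ... | yes refl = e₀-crosses Ze₀ ¬reach
      ... | no e₀≢e with Z? e
      ...   | yes Ze rewrite r-constant-on-Z Ze (e₀≢e ∘ sym) = inside (r (hd e))
        where
        inside : ∀ x → 1ℤ * (x + x) ≡ + 2 * (1ℤ * x) + 0ℤ
        inside = solve-∀
      ...   | no  _  = outside (r (tl e)) (r (hd e))
        where
        outside : ∀ x y → 0ℤ * (x + y) ≡ + 2 * (0ℤ * x) + 0ℤ
        outside = solve-∀

    -- If tl e₀ does not reach hd e₀ through Z - e₀, the vertices that do are left by e₀ alone among
    -- the Z-edges, so summing their Z-degrees counts e₀ once and every other Z-edge twice or not at all.
    even-degree⇒bypass : (∀ v → + 2 ∣ degreeIn (λ e → ind (Z? e)) v) → Z e₀ →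
      Σ[ q ∈ Walk G (tl e₀) (hd e₀) ] AllSteps (λ e _ → Z e × e ≢ e₀) q
    even-degree⇒bypass even Ze₀ with reaches? (tl e₀)
    ... | yes reach = reach
    ... | no ¬reach = ⊥-elim (odd-not-even M (subst (+ 2 ∣_) count weighted-even))
      where
      weighted-even : + 2 ∣ ΣF (λ v → r v * degreeIn z v)
      weighted-even = ΣF-even (λ v → r v * degreeIn z v) (λ v → ∣n⇒∣m*n (r v) (even v))
      M : ℤ
      M = ΣF (λ e → z e * r (tl e))
      count : ΣF (λ v → r v * degreeIn z v) ≡ + 2 * M + 1ℤ
      count = begin
        ΣF (λ v → r v * degreeIn z v)
          ≡⟨ handshake z r ⟩
        ΣF (λ e → z e * (r (tl e) + r (hd e)))
          ≡⟨ ΣF-cong (only-e₀-crosses Ze₀ ¬reach) ⟩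
        ΣF (λ e → + 2 * (z e * r (tl e)) + ind (e₀ ≟ e))
          ≡⟨ ΣF-+ (λ e → + 2 * (z e * r (tl e))) (λ e → ind (e₀ ≟ e)) ⟩
        ΣF (λ e → + 2 * (z e * r (tl e))) + ΣF (λ e → ind (e₀ ≟ e))
          ≡⟨ cong₂ _+_ (*-distribˡ-ΣF (+ 2) (λ e → z e * r (tl e))) ΣF-δ-one ⟨
        + 2 * M + 1ℤ ∎
        where
        ΣF-δ-one : 1ℤ ≡ ΣF (λ e → ind (e₀ ≟ e))
        ΣF-δ-one = sym (trans (ΣF-cong (λ e → sym (ℤP.*-identityˡ (ind (e₀ ≟ e))))) (ΣF-δ e₀ (λ _ → 1ℤ)))

  -- An edge with h e = ±1 contributes the same parity to d v and to deg v, so d v - deg v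
  -- has the parity of the number of zero edges at v.
  zero-edges-even-degree : ∀ {d h} → IsDFlow G d h → IsEven G d →
    ∀ v → + 2 ∣ degreeIn (λ e → ind (h e ℤ.≟ 0ℤ)) v
  zero-edges-even-degree {d} {h} (trit , conserves) even v =
    ∣m+n∣m⇒∣n {m = d v - deg G v} (subst (+ 2 ∣_) total (ΣF-even (λ e → A e + z e * ends e) per-edge′))
                                  (∣ᵤ⇒∣ (even v))
    where
    z : Fin nE → ℤ
    z e = ind (h e ℤ.≟ 0ℤ)
    ends : Fin nE → ℤ
    ends e = ind (tl e ≟ v) + ind (hd e ≟ v)
    A : Fin nE → ℤ
    A e = ind (tl e ≟ v) * (h e - 1ℤ) - ind (hd e ≟ v) * (h e + 1ℤ)

    per-edge : ∀ a b {x} → Trit x → + 2 ∣ (a * (x - 1ℤ) - b * (x + 1ℤ)) + ind (x ℤ.≟ 0ℤ) * (a + b)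
    per-edge a b (inj₁ refl)        = divides (- a) (against a b)
      where
      against : ∀ a b → (a * (-1ℤ - 1ℤ) - b * (-1ℤ + 1ℤ)) + 0ℤ * (a + b) ≡ - a * + 2
      against = solve-∀
    per-edge a b (inj₂ (inj₁ refl)) = divides 0ℤ (idle a b)
      where
      idle : ∀ a b → (a * (0ℤ - 1ℤ) - b * (0ℤ + 1ℤ)) + 1ℤ * (a + b) ≡ 0ℤ * + 2
      idle = solve-∀
    per-edge a b (inj₂ (inj₂ refl)) = divides (- b) (along a b)
      where
      along : ∀ a b → (a * (1ℤ - 1ℤ) - b * (1ℤ + 1ℤ)) + 0ℤ * (a + b) ≡ - b * + 2
      along = solve-∀

    per-edge′ : ∀ e → + 2 ∣ A e + z e * ends e
    per-edge′ e = per-edge (ind (tl e ≟ v)) (ind (hd e ≟ v)) (trit e)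

    expand : ∀ a b x → a * (x - 1ℤ) - b * (x + 1ℤ) ≡ (a * x - b * x) - (a + b)
    expand = solve-∀

    total : ΣF (λ e → A e + z e * ends e) ≡ (d v - deg G v) + degreeIn z v
    total = trans (ΣF-+ A (λ e → z e * ends e)) (cong (_+ degreeIn z v) (begin
      ΣF A
        ≡⟨ ΣF-cong (λ e → expand (ind (tl e ≟ v)) (ind (hd e ≟ v)) (h e)) ⟩
      ΣF (λ e → (ind (tl e ≟ v) * h e - ind (hd e ≟ v) * h e) - ends e)
        ≡⟨ ΣF-- (λ e → ind (tl e ≟ v) * h e - ind (hd e ≟ v) * h e) ends ⟩
      ΣF (λ e → ind (tl e ≟ v) * h e - ind (hd e ≟ v) * h e) - deg G v
        ≡⟨ cong (_- deg G v) (trans (ΣF-- (λ e → ind (tl e ≟ v) * h e) (λ e → ind (hd e ≟ v) * h e)) (conserves v)) ⟩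
      d v - deg G v ∎))

  even-flow⇒full-support : ∀ {d h} → IsDFlow G d h → IsEven G d → IsForestEdges G (λ e → h e ≡ 0ℤ) →
    ∀ e → Supp G h e
  even-flow⇒full-support {h = h} flow even forest e h≡0 =
    forest-edge-is-bridge forest h≡0 (even-degree⇒bypass (λ e → h e ℤ.≟ 0ℤ) (zero-edges-even-degree flow even) h≡0)

module _ (H : PlaneGraph) where
  open PlaneGraph H

  dartTail : Dart nE → Fin nV
  dartTail (e , b) = src graph e b

  faceOf-rot : ∀ x → faceOf (rot x) ≡ faceOf (α x)
  faceOf-rot x = trans (cong (faceOf ∘ rot) (sym (α-involutive x))) (faceOf-φ (α x))
    where
    α-involutive : ∀ x → α (α x) ≡ x
    α-involutive (e , true)  = refl
    α-involutive (e , false) = refl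

  cross : ∀ x → Walk dual (faceOf x) (faceOf (α x))
  cross (e , true)  = cons e false nil
  cross (e , false) = cons e true nil

  turn : ∀ x → Walk dual (faceOf x) (faceOf (rot x))
  turn x = subst (Walk dual (faceOf x)) (sym (faceOf-rot x)) (cross x)

  turns : ∀ k x → Walk dual (faceOf x) (faceOf (iter k rot x))
  turns zero    x = nil
  turns (suc k) x = _++ʷ_ dual (turns k x) (turn (iter k rot x))

  around : ∀ x y → dartTail x ≡ dartTail y → Walk dual (faceOf x) (faceOf y)
  around x y same-tail with rot-cyclic x y same-tail
  ... | k , rotₖx≡y = subst (Walk dual (faceOf x) ∘ faceOf) rotₖx≡y (turns k x)

  alongside : ∀ {u w} → Walk graph u w → ∀ x y → dartTail x ≡ u → dartTail y ≡ w → Walk dual (faceOf x) (faceOf y)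
  alongside nil          x y x-at-u y-at-w = around x y (trans x-at-u (sym y-at-w))
  alongside (cons e b p) x y x-at-u y-at-w =
    _++ʷ_ dual (around x (e , b) x-at-u) (_++ʷ_ dual (cross (e , b)) (alongside p (α (e , b)) y (α-tail b) y-at-w))
    where
    α-tail : ∀ b → dartTail (α (e , b)) ≡ tgt graph e b
    α-tail true  = refl
    α-tail false = refl

  dual-connected : Connected dual
  dual-connected s t with faceOf-surj
  ... | inj₂ surj with surj s | surj t
  ...   | x , refl | y , refl = alongside (connected (dartTail x) (dartTail y)) x y refl refl
  dual-connected s t | inj₁ nE≡0 = subst (Walk dual s) (Fin1-subsingleton nF≡1 s t) nil
    where
    no-edge : Fin nE → ⊥
    no-edge e with subst Fin nE≡0 e
    ... | ()
    nV≡1 : nV ≡ 1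
    nV≡1 = ℕP.≤-antisym (subsingleton⇒≤1 (λ u w → edgeless-walk graph no-edge (connected u w))) nonempty
    nF≡1 : nF ≡ 1
    nF≡1 = ℕP.suc-injective (trans (cong (ℕ._+ nF) (sym nV≡1)) (trans euler (cong (ℕ._+ 2) nE≡0)))

  coboundary : (Fin nF → ℤ) → Fin nE → ℤ
  coboundary g e = g (faceOf (e , true)) - g (faceOf (e , false))

  coboundary-circulation : ∀ g → IsCirculation graph (coboundary g)
  coboundary-circulation g v = begin
    net graph (coboundary g) v
      ≡⟨ ΣF-- (λ e → ind (tl e ≟ v) * coboundary g e) (λ e → ind (hd e ≟ v) * coboundary g e) ⟨
    ΣF (λ e → ind (tl e ≟ v) * coboundary g e - ind (hd e ≟ v) * coboundary g e)
      ≡⟨ ΣF-cong at-edge ⟩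
    ΣF (λ e → (F (e , true) + F (e , false)) - (F (rot (e , true)) + F (rot (e , false))))
      ≡⟨ ΣF-- (λ e → F (e , true) + F (e , false)) (λ e → F (rot (e , true)) + F (rot (e , false))) ⟩
    ΣD F - ΣD (F ∘ rot)
      ≡⟨ cong (_-_ (ΣD F)) (ΣD-permute (mk↔ₛ′ rot rot⁻¹ rot-inv₁ rot-inv₂) F) ⟩
    ΣD F - ΣD F
      ≡⟨ ℤP.+-inverseʳ (ΣD F) ⟩
    0ℤ ∎
    where
    F : Dart nE → ℤ
    F x = ind (dartTail x ≟ v) * g (faceOf x)
    F∘rot : ∀ x → F (rot x) ≡ ind (dartTail x ≟ v) * g (faceOf (α x))
    F∘rot x = cong₂ (λ u f → ind (u ≟ v) * g f) (rot-vertex x) (faceOf-rot x)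
    regroup : ∀ a b x y → a * (x - y) - b * (x - y) ≡ (a * x + b * y) - (a * y + b * x)
    regroup = solve-∀
    at-edge : ∀ e → ind (tl e ≟ v) * coboundary g e - ind (hd e ≟ v) * coboundary g e
                    ≡ (F (e , true) + F (e , false)) - (F (rot (e , true)) + F (rot (e , false)))
    at-edge e = trans (regroup (ind (tl e ≟ v)) (ind (hd e ≟ v)) (g (faceOf (e , true))) (g (faceOf (e , false))))
                      (cong (_-_ (F (e , true) + F (e , false))) (sym (cong₂ _+_ (F∘rot (e , true)) (F∘rot (e , false)))))

  some-dual-path : ∀ s t → Σ[ Q ∈ Walk dual s t ] IsPath dual Q
  some-dual-path s t with toPath dual (λ _ _ → ⊤) (dual-connected s t) (AllSteps-trivial dual (dual-connected s t))
  ... | Q , path , _ = Q , path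

module _ (H : PlaneGraph) {d : Fin (PlaneGraph.nV H) → ℤ} {s t : Fin (PlaneGraph.nF H)} where
  open PlaneGraph H

  circMax-circulation≤0 : ∀ {h c} → IsCircMax H d s t h → IsCirculation graph c → (∀ a → Trit (h a + c a)) →
    ∀ (Q : Walk dual s t) → IsPath dual Q → ∫ dual Q c ℤ.≤ 0ℤ
  circMax-circulation≤0 {h} {c} (flow , max) circ trit Q path =
    +-cancelˡ-≤0 (∫ dual Q h) (∫ dual Q c)
      (subst (ℤ._≤ ∫ dual Q h) (∫-+ dual Q h c) (max Q path (λ a → h a + c a) (flow+circulation graph flow circ trit)))

  circMax-+-circulation : ∀ {h c} → IsCircMax H d s t h → IsCirculation graph c →
    (∀ a → Trit (h a + c a)) → (∀ a → Trit (h a - c a)) → IsCircMax H d s t (λ a → h a + c a)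
  circMax-+-circulation {h} {c} circMax@(flow , max) circ trit⁺ trit⁻ =
    flow+circulation graph flow circ trit⁺ ,
    λ Q path h′ flow′ → subst (∫ dual Q h′ ℤ.≤_) (sym (unchanged Q path)) (max Q path h′ flow′)
    where
    flat : ∀ Q → IsPath dual Q → ∫ dual Q c ≡ 0ℤ
    flat Q path = ℤP.≤-antisym (circMax-circulation≤0 circMax circ trit⁺ Q path)
      (ℤP.neg-cancel-≤ (subst (ℤ._≤ 0ℤ) (∫-neg dual Q c)
        (circMax-circulation≤0 circMax (neg-circulation graph circ) trit⁻ Q path)))
    unchanged : ∀ Q → IsPath dual Q → ∫ dual Q (λ a → h a + c a) ≡ ∫ dual Q h
    unchanged Q path = begin
      ∫ dual Q (λ a → h a + c a)  ≡⟨ ∫-+ dual Q h c ⟩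
      ∫ dual Q h + ∫ dual Q c     ≡⟨ cong (_+_ (∫ dual Q h)) (flat Q path) ⟩
      ∫ dual Q h + 0ℤ             ≡⟨ ℤP.+-identityʳ (∫ dual Q h) ⟩
      ∫ dual Q h                  ∎

  module _ {h : Fin nE → ℤ} (circMax : IsCircMax H d s t h) where
    private
      Saturated : Fin nE → Bool → Set
      Saturated e b = orient b (h e) ≡ 1ℤ

      open Reachability dual Saturated (λ e b → orient b (h e) ℤ.≟ 1ℤ) t

      saturated-integral : ∀ {u} (q : Walk dual u t) → AllSteps dual Saturated q → ∫ dual q h ≡ + ∣E∣ dual q
      saturated-integral {u} nil          _            = ∫-nil dual {u} h
      saturated-integral     (cons e b q) (sat , sats) = trans (∫-cons dual e b q h) (cong₂ _+_ sat (saturated-integral q sats))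

      r : Fin nF → ℤ
      r f = ind (reaches? f)

      -- No dual edge is saturated in the direction from outside R into R, so h e ± 1 stays in {-1, 0, 1}.
      augment-trit : ∀ e → Trit (h e + coboundary H r e)
      augment-trit e with reaches? (faceOf (e , true)) | reaches? (faceOf (e , false)) | proj₁ (proj₁ circMax) e
      ... | yes _ | yes _ | trit = subst Trit (sym (ℤP.+-identityʳ (h e))) trit
      ... | no _  | no _  | trit = subst Trit (sym (ℤP.+-identityʳ (h e))) trit
      ... | yes _ | no _  | inj₁ h≡-1        rewrite h≡-1 = inj₂ (inj₁ refl)
      ... | yes _ | no _  | inj₂ (inj₁ h≡0)  rewrite h≡0  = inj₂ (inj₂ refl)
      ... | yes from-hd | no ¬from-tl | inj₂ (inj₂ h≡1) = ⊥-elim (¬from-tl (reaches-step {b = true} h≡1 from-hd))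
      ... | no ¬from-hd | yes from-tl | inj₁ h≡-1 = ⊥-elim (¬from-hd (reaches-step {b = false} (cong -_ h≡-1) from-tl))
      ... | no _  | yes _ | inj₂ (inj₁ h≡0)  rewrite h≡0  = inj₁ refl
      ... | no _  | yes _ | inj₂ (inj₂ h≡1)  rewrite h≡1  = inj₂ (inj₁ refl)

    circMax-tight-path : ∃ λ (Q : Walk dual s t) → IsPath dual Q × ∫ dual Q h ≡ + ∣E∣ dual Q
    circMax-tight-path with reaches? s
    ... | yes (q , sats) with toPath dual Saturated q sats
    ...   | Q , path , sats′ = Q , path , saturated-integral Q sats′
    circMax-tight-path | no ¬reach with some-dual-path H s t
    ... | Q , path = ⊥-elim (1≰0 (subst (ℤ._≤ 0ℤ) ∫Q-cut
                       (circMax-circulation≤0 circMax (coboundary-circulation H r) augment-trit Q path)))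
      where
      1≰0 : ¬ (1ℤ ℤ.≤ 0ℤ)
      1≰0 (ℤ.+≤+ ())
      ∫Q-cut : ∫ dual Q (coboundary H r) ≡ 1ℤ
      ∫Q-cut = trans (∫-potential dual r Q) (cong₂ _-_ (ind-yes (nil , tt) (reaches? t)) (ind-no ¬reach (reaches? s)))

  circMax-zeros-forest : ∀ {h} → MaxSupport H (IsCircMax H d s t) h → IsForestEdges graph (λ e → h e ≡ 0ℤ)
  circMax-zeros-forest _ nil (() , _) _
  circMax-zeros-forest {h} (circMax , maximal) q@(cons a b q′) (_ , unique@(a∉q′ ∷ _) , _) all-zero@(ha≡0 ∷ _) =
    maximal (λ e → h e + σ graph q e) circMax⁺ support-grows a support-a ha≡0
    where
    zero-or-off : ∀ e → h e ≡ 0ℤ ⊎ σ graph q e ≡ 0ℤ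
    zero-or-off e with DecMembership._∈?_ _≟_ e (edges graph q)
    ... | yes e∈q = inj₁ (All.lookup all-zero e∈q)
    ... | no  e∉q = inj₂ (σ-∉ graph q e∉q)

    shifted-trit : ∀ b e → Trit (h e + orient b (σ graph q e))
    shifted-trit b e with zero-or-off e
    ... | inj₁ h≡0 rewrite h≡0 = subst Trit (sym (ℤP.+-identityˡ _)) (orient-trit b (σ-trit graph q unique e))
    ... | inj₂ σ≡0 rewrite σ≡0 | orient-zero b = subst Trit (sym (ℤP.+-identityʳ (h e))) (proj₁ (proj₁ circMax) e)

    circMax⁺ : IsCircMax H d s t (λ e → h e + σ graph q e)
    circMax⁺ = circMax-+-circulation circMax (σ-closed-circulation graph q) (shifted-trit true) (shifted-trit false)

    support-grows : ∀ e → Supp graph h e → Supp graph (λ e → h e + σ graph q e) e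
    support-grows e h≢0 with zero-or-off e
    ... | inj₁ h≡0 = ⊥-elim (h≢0 h≡0)
    ... | inj₂ σ≡0 = λ h+σ≡0 → h≢0 (trans (sym (ℤP.+-identityʳ (h e))) (trans (cong (_+_ (h e)) (sym σ≡0)) h+σ≡0))

    support-a : Supp graph (λ e → h e + σ graph q e) a
    support-a rewrite ha≡0 | σ-cons-head graph a b q′ (λ a∈q′ → All.lookup a∉q′ a∈q′ refl) = orient-one-≢0 b
      where
      orient-one-≢0 : ∀ b → 0ℤ + orient b 1ℤ ≢ 0ℤ
      orient-one-≢0 true  ()
      orient-one-≢0 false ()

module _ (H : PlaneGraph) {s t : Fin (PlaneGraph.nF H)} where
  open PlaneGraph H

  circMin⇒neg-circMax : ∀ {d h} → IsCircMin H d s t h → IsCircMax H (λ v → - d v) s t (λ a → - h a)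
  circMin⇒neg-circMax {d} {h} (flow , min) = neg-flow graph (λ _ → refl) flow , λ Q path h′ flow′ →
    subst (∫ dual Q h′ ℤ.≤_) (sym (∫-neg dual Q h))
      (≤-neg-swap (subst (∫ dual Q h ℤ.≤_) (∫-neg dual Q h′)
        (min Q path (λ a → - h′ a) (neg-flow graph (λ v → sym (ℤP.neg-involutive (d v))) flow′))))

  neg-circMax⇒circMin : ∀ {d h} → IsCircMax H (λ v → - d v) s t h → IsCircMin H d s t (λ a → - h a)
  neg-circMax⇒circMin {d} {h} (flow , max) = neg-flow graph (λ v → sym (ℤP.neg-involutive (d v))) flow , λ Q path h′ flow′ →
    subst (ℤ._≤ ∫ dual Q h′) (sym (∫-neg dual Q h))
      (neg-≤-swap (subst (ℤ._≤ ∫ dual Q h) (∫-neg dual Q h′)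
        (max Q path (λ a → - h′ a) (neg-flow graph (λ _ → refl) flow′))))

  circMin⇒neg-circMax-maxSupport : ∀ {d h} → MaxSupport H (IsCircMin H d s t) h →
    MaxSupport H (IsCircMax H (λ v → - d v) s t) (λ a → - h a)
  circMin⇒neg-circMax-maxSupport (circMin , maximal) =
    circMin⇒neg-circMax circMin ,
    λ h′ circMax′ grows e h′≢0 → neg-≢0 (maximal (λ a → - h′ a) (neg-circMax⇒circMin circMax′)
                                          (λ e h≢0 → neg-≢0 (grows e (neg-≢0 h≢0))) e (neg-≢0 h′≢0))
    where
    neg-≢0 : ∀ {x} → x ≢ 0ℤ → - x ≢ 0ℤ
    neg-≢0 x≢0 -x≡0 = x≢0 (ℤP.neg-injective -x≡0)

  circMin-tight-path : ∀ {d h} → IsCircMin H d s t h →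
    ∃ λ (Q : Walk dual s t) → IsPath dual Q × ∫ dual Q h ≡ - (+ ∣E∣ dual Q)
  circMin-tight-path {h = h} circMin with circMax-tight-path H (circMin⇒neg-circMax circMin)
  ... | Q , path , ∫-h≡∣E∣ = Q , path , (begin
    ∫ dual Q h                 ≡⟨ ℤP.neg-involutive (∫ dual Q h) ⟨
    - - ∫ dual Q h             ≡⟨ cong -_ (∫-neg dual Q h) ⟨
    - ∫ dual Q (λ a → - h a)   ≡⟨ cong -_ ∫-h≡∣E∣ ⟩
    - (+ ∣E∣ dual Q)           ∎)

  circMin-zeros-forest : ∀ {d h} → MaxSupport H (IsCircMin H d s t) h → IsForestEdges graph (λ e → h e ≡ 0ℤ)
  circMin-zeros-forest maxSupport q cycle zeros =
    circMax-zeros-forest H (circMin⇒neg-circMax-maxSupport maxSupport) q cycle (All.map (cong (λ x → - x)) zeros)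

open PlaneGraph using (graph; dual; nV; nE; nF)

lemma11 : (H : PlaneGraph) (d : Fin (nV H) → ℤ) → ΣF d ≡ + 0 →
    (s t : Fin (nF H)) (h₁ h₂ : Fin (nE H) → ℤ) →
    MaxSupport H (IsCircMax H d s t) h₁ → MaxSupport H (IsCircMin H d s t) h₂ →
    (∃ λ (Q₁ : Walk (dual H) s t) → IsPath (dual H) Q₁ × ∫ (dual H) Q₁ h₁ ≡ + ∣E∣ (dual H) Q₁) ×
    (∃ λ (Q₂ : Walk (dual H) s t) → IsPath (dual H) Q₂ × ∫ (dual H) Q₂ h₂ ≡ - (+ ∣E∣ (dual H) Q₂)) ×
    IsForestEdges (graph H) (λ e → h₁ e ≡ + 0) ×
    IsForestEdges (graph H) (λ e → h₂ e ≡ + 0) ×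
    (IsEven (graph H) d → (∀ e → Supp (graph H) h₁ e) × (∀ e → Supp (graph H) h₂ e))
lemma11 H d _ s t h₁ h₂ max₁@(circMax₁ , _) max₂@(circMin₂ , _) =
  circMax-tight-path H circMax₁ ,
  circMin-tight-path H circMin₂ ,
  forest₁ ,
  forest₂ ,
  λ even → even-flow⇒full-support (graph H) (proj₁ circMax₁) even forest₁ ,
           even-flow⇒full-support (graph H) (proj₁ circMin₂) even forest₂
  where
  forest₁ : IsForestEdges (graph H) (λ e → h₁ e ≡ + 0)
  forest₁ = circMax-zeros-forest H max₁
  forest₂ : IsForestEdges (graph H) (λ e → h₂ e ≡ + 0)
  forest₂ = circMin-zeros-forest H max₂
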